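{- Let $L$ be a $\lambda$-theory. The categories $\mathcal R^{\mathrm{set}}(\mathbf M(L_0))$ and $\mathcal R^{\mathrm{set}}(\mathbf M(L_1))$ are equivalent, where $L_0$ here denotes the monoid $(\{f\in L_0\mid\lambda_0(\rho_0(f))=f\},\circ,\lambda_0(x_{1,1}))$ and $L_1$ denotes the monoid $(L_1,\bullet,x_{1,1})$.
   Context: An algebraic theory $T$: sets $T_n$ ($n\in\mathbb N$), elements $x_{n,i}\in T_n$ ($1\le i\le n$), substitutions $\bullet:T_m\times T_n^m\to T_n$ with $x_j\bullet g=g_j$, $f\bullet(x_{l,i})_i=f$, $(f\bullet g)\bullet h=f\bullet(g_i\bullet h)_i$. Weakening $\iota_{m,n}(f)=f\bullet(x_{m+n,1},\dots,x_{m+n,m})$. A $\lambda$-theory is an algebraic theory $L$ with $\lambda_n:L_{n+1}\to L_n$, $\rho_n:L_n\to L_{n+1}$ such that $\lambda_m(f)\bullet h=\lambda_n(f\bullet(\iota_{n,1}(h_1),\dots,\iota_{n,1}(h_m),x_{n+1,n+1}))$ and $\rho_n(g\bullet h)=\rho_m(g)\bullet(\iota_{n,1}(h_1),\dots,\iota_{n,1}(h_m),x_{n+1,n+1})$ for $f\in L_{m+1},g\in L_m,h\in L_n^m$, and $\rho_n\circ\lambda_n=\mathrm{id}_{L_{n+1}}$. In $L$: application of $f,g\in L_n$ is $fg:=\rho_1(x_{1,1})\bullet(f,g)$; abstraction $\lambda x_{n+1},f:=\lambda_n(f)$; for $a,b\in L_0$, $a\circ b=\lambda x_1,\iota_{0,1}(a)(\iota_{0,1}(b)x_1)\in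 L_0$. In $L_1$, $f\bullet g$ for $f,g\in L_1$ means $f\bullet(g)$. For a monoid $M$, $\mathbf M(M)$ is the one-object category with endomorphisms $M$ and composition the monoid multiplication. For a category $\mathcal C$, $\mathcal R^{\mathrm{set}}(\mathcal C)$ has objects pairs $(X,f)$ with $f:X\to X$ and $f\circ f=f$; morphisms $(X_1,f_1)\to(X_2,f_2)$ are $g:X_1\to X_2$ with $f_2\circ g\circ f_1=g$; identity on $(X,f)$ is $f$; composition from $\mathcal C$. -}

module Defs where

open import Level using (0ℓ)
open import Data.Nat using (ℕ; zero; suc)
open import Data.Fin using (Fin; zero; suc; inject₁; fromℕ)
open import Data.Vec using (Vec; []; _∷_; lookup; tabulate; map; _∷ʳ_)
open import Data.Product using (Σ; _,_; proj₁; proj₂)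
open import Data.Unit using (⊤; tt)
open import Relation.Binary using (Rel; IsEquivalence; Setoid)
open import Relation.Binary.PropositionalEquality
  using (_≡_; refl; sym; trans; cong; cong₂; module ≡-Reasoning)
import Relation.Binary.PropositionalEquality as P
open import Algebra.Bundles using (Monoid)
open import Algebra.Structures using (IsMonoid; IsSemigroup; IsMagma)

-- Algebraic theories.  Tuples T_n^m are vectors  Vec (T n) m ;
-- x_{n,i} is  var n i  (with i : Fin n, 0-based).

record AlgebraicTheory : Set₁ where
  infixl 7 _•_
  field
    T     : ℕ → Set
    var   : (n : ℕ) → Fin n → T n
    _•_   : ∀ {m n} → T m → Vec (T n) m → T n
    var-• : ∀ {m n} (j : Fin m) (g : Vec (T n) m) → var m j • g ≡ lookup g j
    •-var : ∀ {l} (f : T l) → f • tabulate (var l) ≡ f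
    •-assoc : ∀ {l m n} (f : T l) (g : Vec (T m) l) (h : Vec (T n) m) →
              (f • g) • h ≡ f • map (λ gi → gi • h) g

  ι₁ : ∀ {n} → T n → T (suc n)
  ι₁ {n} f = f • tabulate (λ i → var (suc n) (inject₁ i))

  lift : ∀ {m n} → Vec (T n) m → Vec (T (suc n)) (suc m)
  lift {m} {n} h = map ι₁ h ∷ʳ var (suc n) (fromℕ n)

record LambdaTheory : Set₁ where
  field
    alg : AlgebraicTheory
  open AlgebraicTheory alg public
  field
    lam     : ∀ {n} → T (suc n) → T n
    rho     : ∀ {n} → T n → T (suc n)
    lam-•   : ∀ {m n} (f : T (suc m)) (h : Vec (T n) m) →
              lam f • h ≡ lam (f • lift h)
    rho-•   : ∀ {m n} (g : T m) (h : Vec (T n) m) →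
              rho (g • h) ≡ rho g • lift h
    rho-lam : ∀ {n} (f : T (suc n)) → rho (lam f) ≡ f

  app : ∀ {n} → T n → T n → T n
  app f g = rho (var 1 zero) • (f ∷ g ∷ [])

  _⊚_ : T 0 → T 0 → T 0
  a ⊚ b = lam (app (ι₁ a) (app (ι₁ b) (var 1 zero)))

  I : T 0
  I = lam (var 1 zero)

  L₀-elt : Set
  L₀-elt = Σ (T 0) (λ f → lam (rho f) ≡ f)

module _ (L : LambdaTheory) where
  open LambdaTheory L
  open ≡-Reasoning

  private
    x : T 1
    x = var 1 zero

    ι-• : (a : T 0) (u : T 1) → ι₁ a • (u ∷ []) ≡ ι₁ a
    ι-• a u = •-assoc a [] (u ∷ [])

    app-• : ∀ {n k} (f g : T n) (h : Vec (T k) n) →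
            app f g • h ≡ app (f • h) (g • h)
    app-• f g h = •-assoc (rho (var 1 zero)) (f ∷ g ∷ []) h

    β₁ : (N : T 2) (u : T 1) → app (lam N) u ≡ N • (x ∷ u ∷ [])
    β₁ N u = begin
        rho (var 1 zero) • (lam N ∷ u ∷ [])
      ≡⟨ cong₂ (λ p q → rho (var 1 zero) • (p ∷ q ∷ [])) (sym eq₁) (sym (var-• (fromℕ 1) s)) ⟩
        rho (var 1 zero) • (ι₁ (lam N) • s ∷ var 2 (fromℕ 1) • s ∷ [])
      ≡⟨ sym (•-assoc (rho (var 1 zero)) (ι₁ (lam N) ∷ var 2 (fromℕ 1) ∷ []) s) ⟩
        (rho (var 1 zero) • lift (lam N ∷ [])) • s
      ≡⟨ cong (_• s) (sym (rho-• (var 1 zero) (lam N ∷ []))) ⟩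
        rho (var 1 zero • (lam N ∷ [])) • s
      ≡⟨ cong (λ p → rho p • s) (var-• zero (lam N ∷ [])) ⟩
        rho (lam N) • s
      ≡⟨ cong (_• s) (rho-lam N) ⟩
        N • s
      ∎
      where
        s : Vec (T 1) 2
        s = x ∷ u ∷ []
        eq₁ : ι₁ (lam N) • s ≡ lam N
        eq₁ = begin
            ι₁ (lam N) • s
          ≡⟨ •-assoc (lam N) (var 2 zero ∷ []) s ⟩
            lam N • (var 2 zero • s ∷ [])
          ≡⟨ cong (λ p → lam N • (p ∷ [])) (var-• zero s) ⟩
            lam N • tabulate (var 1)
          ≡⟨ •-var (lam N) ⟩
            lam N
          ∎

    ι-lam : (M : T 1) → ι₁ (lam M) ≡ lam (M • (var 2 (suc zero) ∷ []))
    ι-lam M = lam-• M []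

    ιlam-app : (M : T 1) (u : T 1) → app (ι₁ (lam M)) u ≡ M • (u ∷ [])
    ιlam-app M u = begin
        app (ι₁ (lam M)) u
      ≡⟨ cong (λ p → app p u) (ι-lam M) ⟩
        app (lam (M • (var 2 (suc zero) ∷ []))) u
      ≡⟨ β₁ _ u ⟩
        (M • (var 2 (suc zero) ∷ [])) • (x ∷ u ∷ [])
      ≡⟨ •-assoc M _ _ ⟩
        M • (var 2 (suc zero) • (x ∷ u ∷ []) ∷ [])
      ≡⟨ cong (λ p → M • (p ∷ [])) (var-• (suc zero) (x ∷ u ∷ [])) ⟩
        M • (u ∷ [])
      ∎

    comp-app : (b c : T 0) (u : T 1) →
               app (ι₁ (b ⊚ c)) u ≡ app (ι₁ b) (app (ι₁ c) u)
    comp-app b c u = begin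
        app (ι₁ (b ⊚ c)) u
      ≡⟨ ιlam-app _ u ⟩
        app (ι₁ b) (app (ι₁ c) x) • (u ∷ [])
      ≡⟨ app-• (ι₁ b) _ _ ⟩
        app (ι₁ b • (u ∷ [])) (app (ι₁ c) x • (u ∷ []))
      ≡⟨ cong₂ app (ι-• b u) (app-• (ι₁ c) x _) ⟩
        app (ι₁ b) (app (ι₁ c • (u ∷ [])) (x • (u ∷ [])))
      ≡⟨ cong₂ (λ p q → app (ι₁ b) (app p q)) (ι-• c u) (var-• zero (u ∷ [])) ⟩
        app (ι₁ b) (app (ι₁ c) u)
      ∎

    ⊚-assoc : (a b c : T 0) → (a ⊚ b) ⊚ c ≡ a ⊚ (b ⊚ c)
    ⊚-assoc a b c = begin
        lam (app (ι₁ (a ⊚ b)) (app (ι₁ c) x))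
      ≡⟨ cong lam (comp-app a b _) ⟩
        lam (app (ι₁ a) (app (ι₁ b) (app (ι₁ c) x)))
      ≡⟨ cong (λ p → lam (app (ι₁ a) p)) (sym (comp-app b c x)) ⟩
        lam (app (ι₁ a) (app (ι₁ (b ⊚ c)) x))
      ∎

    I-app : (u : T 1) → app (ι₁ I) u ≡ u
    I-app u = trans (ιlam-app x u) (var-• zero (u ∷ []))

    rho-η : (a : T 0) → rho a ≡ app (ι₁ a) x
    rho-η a = begin
        rho a
      ≡⟨ cong rho (sym (var-• zero (a ∷ []))) ⟩
        rho (var 1 zero • (a ∷ []))
      ≡⟨ rho-• (var 1 zero) (a ∷ []) ⟩
        app (ι₁ a) x
      ∎

    ⊚-idˡ : (a : L₀-elt) → I ⊚ proj₁ a ≡ proj₁ a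
    ⊚-idˡ (a , p) = begin
        lam (app (ι₁ I) (app (ι₁ a) x))
      ≡⟨ cong lam (I-app _) ⟩
        lam (app (ι₁ a) x)
      ≡⟨ cong lam (sym (rho-η a)) ⟩
        lam (rho a)
      ≡⟨ p ⟩
        a
      ∎

    ⊚-idʳ : (a : L₀-elt) → proj₁ a ⊚ I ≡ proj₁ a
    ⊚-idʳ (a , p) = begin
        lam (app (ι₁ a) (app (ι₁ I) x))
      ≡⟨ cong (λ q → lam (app (ι₁ a) q)) (I-app x) ⟩
        lam (app (ι₁ a) x)
      ≡⟨ cong lam (sym (rho-η a)) ⟩
        lam (rho a)
      ≡⟨ p ⟩
        a
      ∎

  L₀-monoid : Monoid 0ℓ 0ℓ
  L₀-monoid = record
    { Carrier  = L₀-elt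
    ; _≈_      = λ a b → proj₁ a ≡ proj₁ b
    ; _∙_      = λ a b → (proj₁ a ⊚ proj₁ b) , cong lam (rho-lam _)
    ; ε        = I , cong lam (rho-lam _)
    ; isMonoid = record
      { isSemigroup = record
        { isMagma = record
          { isEquivalence = record { refl = refl ; sym = sym ; trans = trans }
          ; ∙-cong        = cong₂ _⊚_
          }
        ; assoc = λ a b c → ⊚-assoc (proj₁ a) (proj₁ b) (proj₁ c)
        }
      ; identity = ⊚-idˡ , ⊚-idʳ
      }
    }

  L₁-monoid : Monoid 0ℓ 0ℓ
  L₁-monoid = record
    { Carrier  = T 1
    ; _≈_      = _≡_
    ; _∙_      = λ f g → f • (g ∷ [])
    ; ε        = var 1 zero
    ; isMonoid = record
      { isSemigroup = record
        { isMagma = record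
          { isEquivalence = P.isEquivalence
          ; ∙-cong        = cong₂ (λ f g → f • (g ∷ []))
          }
        ; assoc = λ f g h → •-assoc f (g ∷ []) (h ∷ [])
        }
      ; identity = (λ f → var-• zero (f ∷ [])) , (λ f → •-var f)
      }
    }

record Category : Set₁ where
  infix  4 _≈_
  infixr 9 _∘_
  field
    Obj  : Set
    Hom  : Obj → Obj → Set
    _≈_  : ∀ {A B} → Rel (Hom A B) 0ℓ
    ≈-equiv : ∀ {A B} → IsEquivalence (_≈_ {A} {B})
    id   : ∀ {A} → Hom A A
    _∘_  : ∀ {A B C} → Hom B C → Hom A B → Hom A C
    assoc : ∀ {A B C D} (f : Hom A B) (g : Hom B C) (h : Hom C D) →
            (h ∘ g) ∘ f ≈ h ∘ (g ∘ f)
    identityˡ : ∀ {A B} (f : Hom A B) → id ∘ f ≈ f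
    identityʳ : ∀ {A B} (f : Hom A B) → f ∘ id ≈ f
    ∘-resp-≈ : ∀ {A B C} {f h : Hom B C} {g i : Hom A B} →
               f ≈ h → g ≈ i → f ∘ g ≈ h ∘ i

  hom-setoid : Obj → Obj → Setoid 0ℓ 0ℓ
  hom-setoid A B = record { Carrier = Hom A B ; _≈_ = _≈_ ; isEquivalence = ≈-equiv }

record Functor (C D : Category) : Set where
  private
    module C = Category C
    module D = Category D
  field
    F₀ : C.Obj → D.Obj
    F₁ : ∀ {A B} → C.Hom A B → D.Hom (F₀ A) (F₀ B)
    F-resp-≈ : ∀ {A B} {f g : C.Hom A B} → f C.≈ g → F₁ f D.≈ F₁ g
    identity : ∀ {A} → F₁ (C.id {A}) D.≈ D.id
    homomorphism : ∀ {A B E} (f : C.Hom A B) (g : C.Hom B E) →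
                   F₁ (g C.∘ f) D.≈ F₁ g D.∘ F₁ f

idF : (C : Category) → Functor C C
idF C = record
  { F₀ = λ A → A ; F₁ = λ f → f ; F-resp-≈ = λ p → p
  ; identity = IsEquivalence.refl ≈-equiv
  ; homomorphism = λ f g → IsEquivalence.refl ≈-equiv }
  where open Category C

_∘F_ : ∀ {C D E} → Functor D E → Functor C D → Functor C E
_∘F_ {C} {D} {E} G F = record
  { F₀ = λ A → G.F₀ (F.F₀ A)
  ; F₁ = λ f → G.F₁ (F.F₁ f)
  ; F-resp-≈ = λ p → G.F-resp-≈ (F.F-resp-≈ p)
  ; identity = IsEquivalence.trans E.≈-equiv (G.F-resp-≈ F.identity) G.identity
  ; homomorphism = λ f g → IsEquivalence.trans E.≈-equiv
      (G.F-resp-≈ (F.homomorphism f g)) (G.homomorphism (F.F₁ f) (F.F₁ g))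
  }
  where
    module F = Functor F
    module G = Functor G
    module E = Category E

record NaturalIsomorphism {C D : Category} (F G : Functor C D) : Set where
  private
    module C = Category C
    module D = Category D
    module F = Functor F
    module G = Functor G
  field
    η   : ∀ A → D.Hom (F.F₀ A) (G.F₀ A)
    η⁻¹ : ∀ A → D.Hom (G.F₀ A) (F.F₀ A)
    isoˡ : ∀ A → η⁻¹ A D.∘ η A D.≈ D.id
    isoʳ : ∀ A → η A D.∘ η⁻¹ A D.≈ D.id
    commute : ∀ {A B} (f : C.Hom A B) → η B D.∘ F.F₁ f D.≈ G.F₁ f D.∘ η A

record Equivalence (C D : Category) : Set where
  field
    F : Functor C D
    G : Functor D C
    unit   : NaturalIsomorphism (idF C) (G ∘F F)
    counit : NaturalIsomorphism (F ∘F G) (idF D)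

𝐌 : Monoid 0ℓ 0ℓ → Category
𝐌 M = record
  { Obj = ⊤
  ; Hom = λ _ _ → Carrier
  ; _≈_ = _≈_
  ; ≈-equiv = isEquivalence
  ; id = ε
  ; _∘_ = _∙_
  ; assoc = λ f g h → assoc h g f
  ; identityˡ = identityˡ
  ; identityʳ = identityʳ
  ; ∘-resp-≈ = ∙-cong
  }
  where open Monoid M

ℛset : Category → Category
ℛset C = record
  { Obj = Σ Obj (λ X → Σ (Hom X X) (λ f → f ∘ f ≈ f))
  ; Hom = λ A B → Σ (Hom (proj₁ A) (proj₁ B))
                     (λ g → (proj₁ (proj₂ B) ∘ g) ∘ proj₁ (proj₂ A) ≈ g)
  ; _≈_ = λ g h → proj₁ g ≈ proj₁ h
  ; ≈-equiv = record { refl = IsEquivalence.refl ≈-equiv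
                     ; sym = IsEquivalence.sym ≈-equiv
                     ; trans = IsEquivalence.trans ≈-equiv }
  ; id = λ {A} → proj₁ (proj₂ A) , id-ok (proj₂ A)
  ; _∘_ = λ {A} {B} {E} h g → (proj₁ h ∘ proj₁ g) , comp-ok (proj₂ A) (proj₂ B) (proj₂ E) h g
  ; assoc = λ f g h → assoc (proj₁ f) (proj₁ g) (proj₁ h)
  ; identityˡ = λ {A} {B} g → absorbˡ (proj₂ A) (proj₂ B) g
  ; identityʳ = λ {A} {B} g → absorbʳ (proj₂ A) (proj₂ B) g
  ; ∘-resp-≈ = ∘-resp-≈
  }
  where
    open Category C
    module S {A B : Obj} = Setoid (hom-setoid A B)
    import Relation.Binary.Reasoning.Setoid as SR

    Idem : Obj → Set
    Idem X = Σ (Hom X X) (λ f → f ∘ f ≈ f)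

    id-ok : ∀ {X} (e : Idem X) → (proj₁ e ∘ proj₁ e) ∘ proj₁ e ≈ proj₁ e
    id-ok {X} (f , p) = S.trans (∘-resp-≈ p S.refl) p

    absorbˡ : ∀ {X Y} (e₁ : Idem X) (e₂ : Idem Y) →
              (g : Σ (Hom X Y) (λ g → (proj₁ e₂ ∘ g) ∘ proj₁ e₁ ≈ g)) →
              proj₁ e₂ ∘ proj₁ g ≈ proj₁ g
    absorbˡ {X} {Y} (f₁ , p₁) (f₂ , p₂) (g , q) = begin
        f₂ ∘ g
      ≈⟨ ∘-resp-≈ S.refl (S.sym q) ⟩
        f₂ ∘ ((f₂ ∘ g) ∘ f₁)
      ≈⟨ S.sym (assoc f₁ (f₂ ∘ g) f₂) ⟩
        (f₂ ∘ (f₂ ∘ g)) ∘ f₁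
      ≈⟨ ∘-resp-≈ (S.sym (assoc g f₂ f₂)) S.refl ⟩
        ((f₂ ∘ f₂) ∘ g) ∘ f₁
      ≈⟨ ∘-resp-≈ (∘-resp-≈ p₂ S.refl) S.refl ⟩
        (f₂ ∘ g) ∘ f₁
      ≈⟨ q ⟩
        g
      ∎
      where open SR (hom-setoid X Y)

    absorbʳ : ∀ {X Y} (e₁ : Idem X) (e₂ : Idem Y) →
              (g : Σ (Hom X Y) (λ g → (proj₁ e₂ ∘ g) ∘ proj₁ e₁ ≈ g)) →
              proj₁ g ∘ proj₁ e₁ ≈ proj₁ g
    absorbʳ {X} {Y} (f₁ , p₁) (f₂ , p₂) (g , q) = begin
        g ∘ f₁
      ≈⟨ ∘-resp-≈ (S.sym q) S.refl ⟩
        ((f₂ ∘ g) ∘ f₁) ∘ f₁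
      ≈⟨ assoc f₁ f₁ (f₂ ∘ g) ⟩
        (f₂ ∘ g) ∘ (f₁ ∘ f₁)
      ≈⟨ ∘-resp-≈ S.refl p₁ ⟩
        (f₂ ∘ g) ∘ f₁
      ≈⟨ q ⟩
        g
      ∎
      where open SR (hom-setoid X Y)

    comp-ok : ∀ {X Y Z} (e₁ : Idem X) (e₂ : Idem Y) (e₃ : Idem Z) →
              (h : Σ (Hom Y Z) (λ h → (proj₁ e₃ ∘ h) ∘ proj₁ e₂ ≈ h)) →
              (g : Σ (Hom X Y) (λ g → (proj₁ e₂ ∘ g) ∘ proj₁ e₁ ≈ g)) →
              (proj₁ e₃ ∘ (proj₁ h ∘ proj₁ g)) ∘ proj₁ e₁ ≈ proj₁ h ∘ proj₁ g
    comp-ok {X} {Y} {Z} e₁ e₂ e₃ h g = begin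
        (f₃ ∘ (proj₁ h ∘ proj₁ g)) ∘ f₁
      ≈⟨ ∘-resp-≈ (S.sym (assoc (proj₁ g) (proj₁ h) f₃)) S.refl ⟩
        ((f₃ ∘ proj₁ h) ∘ proj₁ g) ∘ f₁
      ≈⟨ ∘-resp-≈ (∘-resp-≈ (absorbˡ e₂ e₃ h) S.refl) S.refl ⟩
        (proj₁ h ∘ proj₁ g) ∘ f₁
      ≈⟨ assoc f₁ (proj₁ g) (proj₁ h) ⟩
        proj₁ h ∘ (proj₁ g ∘ f₁)
      ≈⟨ ∘-resp-≈ S.refl (absorbʳ e₁ e₂ g) ⟩
        proj₁ h ∘ proj₁ g
      ∎
      where
        open SR (hom-setoid X Z)
        f₁ = proj₁ e₁
        f₃ = proj₁ e₃

{-# OPTIONS --safe #-}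
-- Since a ∘ b = λ₀(ρ₀ a • ρ₀ b), the maps ρ₀ and λ₀ are mutually inverse
-- monoid isomorphisms between {f ∈ L₀ | λ₀(ρ₀ f) = f} and L₁.  A functor lifts
-- to the categories of idempotents, and a functor on ℛset(𝐌 M) that is the
-- identity on morphisms is isomorphic to the identity functor, with every
-- component given by the idempotent itself.
module Submission where

open import Defs
open import Level using (0ℓ)
open import Data.Fin using (zero)
open import Data.Vec using (Vec; []; _∷_)
open import Data.Product using (_,_; proj₁; proj₂)
open import Data.Unit using (tt)
open import Relation.Binary.Bundles using (Setoid)
open import Relation.Binary.PropositionalEquality using (_≡_)
import Relation.Binary.PropositionalEquality as ≡
open import Algebra.Bundles using (Monoid)
open import Algebra.Morphism.Structures using (IsMonoidHomomorphism)

module _ {C D : Category} (F : Functor C D) where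
  private
    module C = Category C
    module D = Category D
    module DS {A B} = Setoid (D.hom-setoid A B)
  open Functor F

  F-preserves-idempotent : ∀ {X} {e : C.Hom X X} →
                           e C.∘ e C.≈ e → F₁ e D.∘ F₁ e D.≈ F₁ e
  F-preserves-idempotent {e = e} idem = DS.trans (DS.sym (homomorphism e e)) (F-resp-≈ idem)

  F-preserves-sandwich : ∀ {X Y} {e₁ : C.Hom X X} {e₂ : C.Hom Y Y} {g : C.Hom X Y} →
                         (e₂ C.∘ g) C.∘ e₁ C.≈ g →
                         (F₁ e₂ D.∘ F₁ g) D.∘ F₁ e₁ D.≈ F₁ g
  F-preserves-sandwich {e₁ = e₁} {e₂} {g} q = DS.trans
    (DS.sym (DS.trans (homomorphism e₁ (e₂ C.∘ g))
                      (D.∘-resp-≈ (homomorphism g e₂) DS.refl)))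
    (F-resp-≈ q)

  ℛset-map : Functor (ℛset C) (ℛset D)
  ℛset-map = record
    { F₀ = λ { (X , e , idem) → F₀ X , F₁ e , F-preserves-idempotent idem }
    ; F₁ = λ { (g , q) → F₁ g , F-preserves-sandwich q }
    ; F-resp-≈ = F-resp-≈
    ; identity = DS.refl
    ; homomorphism = λ f g → homomorphism (proj₁ f) (proj₁ g)
    }

𝐌-map : {M N : Monoid 0ℓ 0ℓ} {φ : Monoid.Carrier M → Monoid.Carrier N} →
        IsMonoidHomomorphism (Monoid.rawMonoid M) (Monoid.rawMonoid N) φ →
        Functor (𝐌 M) (𝐌 N)
𝐌-map {φ = φ} φ-hom = record
  { F₀ = λ _ → tt
  ; F₁ = φ
  ; F-resp-≈ = ⟦⟧-cong
  ; identity = ε-homo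
  ; homomorphism = λ f g → homo g f
  }
  where open IsMonoidHomomorphism φ-hom

module _ (M : Monoid 0ℓ 0ℓ) where
  open Monoid M using (Carrier; _≈_; _∙_; ∙-cong; refl; sym; trans)
  open Category (ℛset (𝐌 M)) using (Obj; Hom; id; identityˡ; identityʳ)

  idempotent : Obj → Carrier
  idempotent A = proj₁ (proj₂ A)

  idempotents-intertwine : ∀ {A B} (f : Hom A B) {g h : Carrier} →
                           g ≈ proj₁ f → h ≈ proj₁ f →
                           idempotent B ∙ g ≈ h ∙ idempotent A
  -- The identity laws of ℛset say that idempotents absorb morphisms.
  idempotents-intertwine {A} {B} f g≈f h≈f = trans (∙-cong refl g≈f)
    (trans (identityˡ {A} {B} f) (sym (trans (∙-cong h≈f refl) (identityʳ {A} {B} f))))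

  module _ (H : Functor (ℛset (𝐌 M)) (ℛset (𝐌 M)))
           (H≈id : ∀ {A B} (f : Hom A B) → proj₁ (Functor.F₁ H {A} {B} f) ≈ proj₁ f) where
    open Functor H

    idempotent-fixed : ∀ A → idempotent (F₀ A) ≈ idempotent A
    idempotent-fixed A = trans (sym (identity {A})) (H≈id {A} {A} (id {A}))

    to-F₀ : ∀ A → Hom A (F₀ A)
    to-F₀ A = idempotent A ,
      trans (∙-cong (∙-cong (idempotent-fixed A) refl) refl) (proj₂ (id {A}))

    from-F₀ : ∀ A → Hom (F₀ A) A
    from-F₀ A = idempotent A ,
      trans (∙-cong refl (idempotent-fixed A)) (proj₂ (id {A}))

    idF≅ : NaturalIsomorphism (idF (ℛset (𝐌 M))) H
    idF≅ = record
      { η = to-F₀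
      ; η⁻¹ = from-F₀
      ; isoˡ = λ A → proj₂ (proj₂ A)
      ; isoʳ = λ A → trans (proj₂ (proj₂ A)) (sym (idempotent-fixed A))
      ; commute = λ {A} {B} f → idempotents-intertwine {A} {B} f refl (H≈id {A} {B} f)
      }

    ≅idF : NaturalIsomorphism H (idF (ℛset (𝐌 M)))
    ≅idF = record
      { η = from-F₀
      ; η⁻¹ = to-F₀
      ; isoˡ = λ A → trans (proj₂ (proj₂ A)) (sym (idempotent-fixed A))
      ; isoʳ = λ A → proj₂ (proj₂ A)
      ; commute = λ {A} {B} f → idempotents-intertwine {A} {B} f (H≈id {A} {B} f) refl
      }

ℛset-𝐌-equivalence :
  {M N : Monoid 0ℓ 0ℓ}
  {φ : Monoid.Carrier M → Monoid.Carrier N} {ψ : Monoid.Carrier N → Monoid.Carrier M} →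
  IsMonoidHomomorphism (Monoid.rawMonoid M) (Monoid.rawMonoid N) φ →
  IsMonoidHomomorphism (Monoid.rawMonoid N) (Monoid.rawMonoid M) ψ →
  (∀ a → Monoid._≈_ M (ψ (φ a)) a) → (∀ b → Monoid._≈_ N (φ (ψ b)) b) →
  Equivalence (ℛset (𝐌 M)) (ℛset (𝐌 N))
ℛset-𝐌-equivalence {M} {N} φ-hom ψ-hom ψφ≈id φψ≈id = record
  { F = ℛset-map (𝐌-map {M} {N} φ-hom)
  ; G = ℛset-map (𝐌-map {N} {M} ψ-hom)
  ; unit = idF≅ M _ (λ f → ψφ≈id (proj₁ f))
  ; counit = ≅idF N _ (λ f → φψ≈id (proj₁ f))
  }

module _ (L : LambdaTheory) where
  open LambdaTheory L
  open ≡ using (refl; sym; trans; cong; cong₂)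
  open ≡.≡-Reasoning

  private
    x : T 1
    x = var 1 zero

  app-• : ∀ {m n} (f g : T m) (h : Vec (T n) m) → app f g • h ≡ app (f • h) (g • h)
  app-• f g h = •-assoc (rho x) (f ∷ g ∷ []) h

  rho-app : (a : T 0) → rho a ≡ app (ι₁ a) x
  rho-app a = trans (cong rho (sym (var-• zero (a ∷ [])))) (rho-• x (a ∷ []))

  rho-•-app : ∀ {n} (a : T 0) (u : T n) → rho a • (u ∷ []) ≡ app (a • []) u
  rho-•-app a u = begin
      rho a • (u ∷ [])
    ≡⟨ cong (_• (u ∷ [])) (rho-app a) ⟩
      app (ι₁ a) x • (u ∷ [])
    ≡⟨ app-• (ι₁ a) x (u ∷ []) ⟩
      app (ι₁ a • (u ∷ [])) (x • (u ∷ []))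
    ≡⟨ cong₂ app (•-assoc a [] (u ∷ [])) (var-• zero (u ∷ [])) ⟩
      app (a • []) u
    ∎

  ⊚-via-rho : (a b : T 0) → a ⊚ b ≡ lam (rho a • (rho b ∷ []))
  ⊚-via-rho a b = cong lam (begin
      app (ι₁ a) (app (ι₁ b) x)
    ≡⟨ cong (app (ι₁ a)) (sym (rho-app b)) ⟩
      app (ι₁ a) (rho b)
    ≡⟨ sym (rho-•-app a (rho b)) ⟩
      rho a • (rho b ∷ [])
    ∎)

  rho-⊚ : (a b : T 0) → rho (a ⊚ b) ≡ rho a • (rho b ∷ [])
  rho-⊚ a b = trans (cong rho (⊚-via-rho a b)) (rho-lam _)

  lam-⊚ : (f g : T 1) → lam f ⊚ lam g ≡ lam (f • (g ∷ []))
  lam-⊚ f g = trans (⊚-via-rho (lam f) (lam g))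
    (cong₂ (λ p q → lam (p • (q ∷ []))) (rho-lam f) (rho-lam g))

  lam₀ : T 1 → L₀-elt
  lam₀ f = lam f , cong lam (rho-lam f)

  rho-isMonoidHomomorphism :
    IsMonoidHomomorphism (Monoid.rawMonoid (L₀-monoid L)) (Monoid.rawMonoid (L₁-monoid L))
                         (λ a → rho (proj₁ a))
  rho-isMonoidHomomorphism = record
    { isMagmaHomomorphism = record
      { isRelHomomorphism = record { cong = cong rho }
      ; homo = λ a b → rho-⊚ (proj₁ a) (proj₁ b)
      }
    ; ε-homo = rho-lam x
    }

  lam₀-isMonoidHomomorphism :
    IsMonoidHomomorphism (Monoid.rawMonoid (L₁-monoid L)) (Monoid.rawMonoid (L₀-monoid L)) lam₀
  lam₀-isMonoidHomomorphism = record
    { isMagmaHomomorphism = record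
      { isRelHomomorphism = record { cong = cong lam }
      ; homo = λ f g → sym (lam-⊚ f g)
      }
    ; ε-homo = refl
    }

proposition48 : (L : LambdaTheory) → Equivalence (ℛset (𝐌 (L₀-monoid L))) (ℛset (𝐌 (L₁-monoid L)))
proposition48 L = ℛset-𝐌-equivalence {L₀-monoid L} {L₁-monoid L}
  (rho-isMonoidHomomorphism L) (lam₀-isMonoidHomomorphism L)
  proj₂ (LambdaTheory.rho-lam L)
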